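{- Let $\mathcal{Z}$ be an expansion of $(\mathbb{Z},+,0,1)$, and let $A\subseteq\mathbb{N}$ be infinite and definable in $\mathcal{Z}$. Let $k\ge2$ and suppose that $A$ does not have large lower-asymptotic $k$-tupling. Then $\mathcal{Z}$ does not eliminate $\exists^\infty$.
   Context: Here $\mathbb{N}=\{0,1,2,\dots\}$; "definable" means definable with parameters; an expansion of $(\mathbb{Z},+,0,1)$ is a structure on $\mathbb{Z}$ in a language containing $+,0,1$ with usual interpretation. For $A\subseteq\mathbb{N}$, $A_{\le n}=A\cap[0,n]$ and $k\cdot B=\{b_1+\dots+b_k: b_i\in B\}$. An infinite $A\subseteq\mathbb{N}$ has large lower-asymptotic $k$-tupling if $\liminf_{n\to\infty}\frac{|k\cdot A_{\le n}|}{|A_{\le n}|^k}>0$. A structure $M$ eliminates $\exists^\infty$ if for every formula $\phi(x,y)$ with $|x|=1$ there is $N\in\mathbb{N}$ such that for all $b$, if $\phi(M,b)$ is finite then $|\phi(M,b)|<N$. -}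

module Defs where

open import Data.Nat using (ℕ; zero; suc; _≤_; _<_; _^_) renaming (_+_ to _+ℕ_; _*_ to _*ℕ_)
open import Data.Integer using (ℤ; +_) renaming (_+_ to _+ℤ_)
open import Data.Fin using (Fin)
open import Data.Vec using (Vec; []; _∷_; lookup; sum)
open import Data.Vec.Relation.Unary.All using (All)
open import Data.List using (List; length)
open import Data.List.Membership.Propositional using (_∈_)
open import Data.List.Relation.Unary.Unique.Propositional using (Unique)
open import Data.Product using (Σ; _×_; ∃; ∃-syntax)
open import Relation.Binary.PropositionalEquality using (_≡_)
open import Relation.Nullary using (¬_)
open import Data.Empty using (⊥)
open import Function.Bundles using (_⇔_)

record Expansion : Set₁ where
  field
    Fun    : ℕ → Set
    Rel    : ℕ → Set
    funI   : ∀ {n} → Fun n → Vec ℤ n → ℤ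
    relI   : ∀ {n} → Rel n → Vec ℤ n → Set
    plusS  : Fun 2
    zeroS  : Fun 0
    oneS   : Fun 0
    plusI  : ∀ a b → funI plusS (a ∷ b ∷ []) ≡ a +ℤ b
    zeroI  : funI zeroS [] ≡ + 0
    oneI   : funI oneS [] ≡ + 1

module _ (Z : Expansion) where
  open Expansion Z

  data Term (n : ℕ) : Set where
    var : Fin n → Term n
    app : ∀ {m} → Fun m → Vec (Term n) m → Term n

  data Formula : ℕ → Set where
    _≐_   : ∀ {n} → Term n → Term n → Formula n
    rel   : ∀ {n m} → Rel m → Vec (Term n) m → Formula n
    ⊥f    : ∀ {n} → Formula n
    _⇒f_  : ∀ {n} → Formula n → Formula n → Formula n
    _∧f_  : ∀ {n} → Formula n → Formula n → Formula n
    _∨f_  : ∀ {n} → Formula n → Formula n → Formula n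
    ∀f    : ∀ {n} → Formula (suc n) → Formula n
    ∃f    : ∀ {n} → Formula (suc n) → Formula n

  mutual
    evalT : ∀ {n} → Vec ℤ n → Term n → ℤ
    evalT ρ (var i)    = lookup ρ i
    evalT ρ (app f ts) = funI f (evalTs ρ ts)

    evalTs : ∀ {n m} → Vec ℤ n → Vec (Term n) m → Vec ℤ m
    evalTs ρ []       = []
    evalTs ρ (t ∷ ts) = evalT ρ t ∷ evalTs ρ ts

  Sat : ∀ {n} → Formula n → Vec ℤ n → Set
  Sat (s ≐ t)   ρ = evalT ρ s ≡ evalT ρ t
  Sat (rel r ts) ρ = relI r (evalTs ρ ts)
  Sat ⊥f        ρ = ⊥
  Sat (φ ⇒f ψ)  ρ = Sat φ ρ → Sat ψ ρ
  Sat (φ ∧f ψ)  ρ = Sat φ ρ × Sat ψ ρ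
  Sat (φ ∨f ψ)  ρ = Data.Sum._⊎_ (Sat φ ρ) (Sat ψ ρ)
    where import Data.Sum
  Sat (∀f φ)    ρ = (z : ℤ) → Sat φ (z ∷ ρ)
  Sat (∃f φ)    ρ = Σ ℤ λ z → Sat φ (z ∷ ρ)

Finite : {X : Set} → (X → Set) → Set
Finite {X} P = Σ (List X) λ xs → ∀ x → P x → x ∈ xs

Infinite : {X : Set} → (X → Set) → Set
Infinite P = ¬ Finite P

FiniteBelow : {X : Set} → ℕ → (X → Set) → Set
FiniteBelow {X} N P = Σ (List X) λ xs → (length xs < N) × (∀ x → P x → x ∈ xs)

HasCard : {X : Set} → (X → Set) → ℕ → Set
HasCard {X} P m = Σ (List X) λ xs → Unique xs × (∀ x → (x ∈ xs) ⇔ P x) × (length xs ≡ m)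

_≤[_] : (ℕ → Set) → ℕ → (ℕ → Set)
(A ≤[ n ]) a = A a × (a ≤ n)

_·_ : ℕ → (ℕ → Set) → (ℕ → Set)
(k · B) s = Σ (Vec ℕ k) λ v → All B v × (sum v ≡ s)

-- liminf_{n→∞} |k·A_{≤n}| / |A_{≤n}|^k > 0, i.e. there is a rational
-- ε = suc p / suc q > 0 such that eventually |k·A_{≤n}| ≥ ε |A_{≤n}|^k.
LargeLowerAsymptoticTupling : ℕ → (ℕ → Set) → Set
LargeLowerAsymptoticTupling k A =
  ∃[ p ] ∃[ q ] ∃[ N ] ∀ n → N ≤ n → ∀ a s →
    HasCard (A ≤[ n ]) a → HasCard (k · (A ≤[ n ])) s →
    suc p *ℕ (a ^ k) ≤ suc q *ℕ s

Definable : (Z : Expansion) → (ℕ → Set) → Set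
Definable Z A = Σ ℕ λ m → Σ (Formula Z (suc m)) λ φ → Σ (Vec ℤ m) λ b →
  ∀ (z : ℤ) → Sat Z φ (z ∷ b) ⇔ (Σ ℕ λ a → (z ≡ + a) × A a)

EliminatesExistsInfinity : Expansion → Set
EliminatesExistsInfinity Z = ∀ m (φ : Formula Z (suc m)) → Σ ℕ λ N →
  ∀ (b : Vec ℤ m) → Finite (λ z → Sat Z φ (z ∷ b)) →
    FiniteBelow N (λ z → Sat Z φ (z ∷ b))

-- Suppose A is defined by φ(x, b̄) and 𝒵 eliminates ∃^∞. For each j the formula
-- ψⱼ(x, y) := "x ∈ A and y − x ∈ j·A" has finite fibres ψⱼ(𝒵, y) ⊆ [0, y], hence
-- fibres of size below a uniform Nⱼ. Consequently, for every finite L ⊆ A, each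
-- y is the sum of a j-tuple from L in at most Cⱼ := N₀ ⋯ N_{j-1} ways, so
-- |L|^k ≤ C_k |k·L|. Applied to L = A_{≤n} this is large lower-asymptotic
-- k-tupling with constant 1 / (C_k + 1).
module Submission where

open import Defs
open import Data.Nat using (ℕ; _≤_)
open import Relation.Nullary using (¬_)

open import Algebra.Properties.CommutativeSemigroup using (interchange)
open import Data.Empty using (⊥; ⊥-elim)
open import Data.Fin using (Fin; zero; suc; lift; _↑ˡ_; _↑ʳ_)
open import Data.Integer using (ℤ; +_; ∣_∣)
open import Data.Integer.Properties using (+-injective)
open import Data.List using (List; []; _∷_; length; map; _++_; upTo)
open import Data.List.Membership.Propositional using (_∈_; _─_)
open import Data.List.Membership.Propositional.Properties using (∈-++⁻; ∈-map⁺; ∈-map⁻; ∈-upTo⁺)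
open import Data.List.Properties using (length-++; length-map; length-removeAt′)
import Data.List.Relation.Unary.All as All
open import Data.List.Relation.Unary.Any using (here; there; index)
open import Data.List.Relation.Unary.AllPairs using (_∷_)
open import Data.List.Relation.Unary.Unique.Propositional using (Unique)
open import Data.Nat using (zero; suc; _<_; _+_; _*_; _∸_; _^_; _≟_; z≤n; s≤s)
open import Data.Nat.ListAction using (sum)
open import Data.Nat.Properties
open import Data.Product using (Σ; _×_; _,_; proj₁; proj₂; ∃-syntax)
open import Data.Product.Function.NonDependent.Propositional using (_×-⇔_)
open import Data.Sum using (inj₁; inj₂)
open import Data.Sum.Function.Propositional using (_⊎-⇔_)
open import Data.Vec as Vec using (Vec; []; _∷_; lookup)
open import Data.Vec.Properties using (lookup-++ˡ; lookup-++ʳ)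
open import Data.Vec.Relation.Unary.All using ([]; _∷_)
open import Function using (_∘_)
open import Function.Bundles using (_⇔_; mk⇔; Equivalence)
open import Function.Construct.Identity using (⇔-id)
open import Function.Related.TypeIsomorphisms using (→-cong-⇔)
open import Relation.Nullary using (yes; no)
open import Relation.Binary.PropositionalEquality

open Equivalence using (to; from)

δ : ℕ → ℕ → ℕ
δ y z with y ≟ z
... | yes _ = 1
... | no  _ = 0

δ≤1 : ∀ y z → δ y z ≤ 1
δ≤1 y z with y ≟ z
... | yes _ = s≤s z≤n
... | no  _ = z≤n

δ-refl : ∀ y → δ y y ≡ 1
δ-refl y with y ≟ y
... | yes _   = refl
... | no  y≢y = ⊥-elim (y≢y refl)

δ-+ : ∀ y x z → δ y (x + z) ≤ δ (y ∸ x) z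
δ-+ y x z with y ≟ x + z
... | no  _    = z≤n
... | yes refl = ≤-reflexive (sym (trans (cong (λ t → δ t z) (m+n∸m≡n x z)) (δ-refl z)))

count : ℕ → List ℕ → ℕ
count y []       = 0
count y (z ∷ zs) = δ y z + count y zs

count-++ : ∀ y xs ys → count y (xs ++ ys) ≡ count y xs + count y ys
count-++ y []       ys = refl
count-++ y (x ∷ xs) ys = trans (cong (_+_ (δ y x)) (count-++ y xs ys)) (sym (+-assoc (δ y x) _ _))

count-map-+ : ∀ y x zs → count y (map (_+_ x) zs) ≤ count (y ∸ x) zs
count-map-+ y x []       = z≤n
count-map-+ y x (z ∷ zs) = +-mono-≤ (δ-+ y x z) (count-map-+ y x zs)

count>0⇒∈ : ∀ {y} zs → 0 < count y zs → y ∈ zs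
count>0⇒∈ {y} (z ∷ zs) pos with y ≟ z
... | yes refl = here refl
... | no  _    = there (count>0⇒∈ zs pos)

sum-map-+ : (f g : ℕ → ℕ) (K : List ℕ) →
  sum (map (λ y → f y + g y) K) ≡ sum (map f K) + sum (map g K)
sum-map-+ f g []      = refl
sum-map-+ f g (y ∷ K) = trans (cong (_+_ (f y + g y)) (sum-map-+ f g K))
  (interchange +-commutativeSemigroup (f y) (g y) (sum (map f K)) (sum (map g K)))

1≤sum-δ : ∀ {z} K → z ∈ K → 1 ≤ sum (map (λ y → δ y z) K)
1≤sum-δ {z} (y ∷ K) (here refl) = ≤-trans (≤-reflexive (sym (δ-refl z))) (m≤m+n (δ z z) _)
1≤sum-δ     (y ∷ K) (there z∈K) = ≤-trans (1≤sum-δ K z∈K) (m≤n+m _ _)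

length≤sum-count : ∀ K zs → (∀ {z} → z ∈ zs → z ∈ K) → length zs ≤ sum (map (λ y → count y zs) K)
length≤sum-count K []       _    = z≤n
length≤sum-count K (z ∷ zs) zs⊆K = begin
  1 + length zs                                                  ≤⟨ +-mono-≤ (1≤sum-δ K (zs⊆K (here refl)))
                                                                               (length≤sum-count K zs (zs⊆K ∘ there)) ⟩
  sum (map (λ y → δ y z) K) + sum (map (λ y → count y zs) K)     ≡⟨ sum-map-+ (λ y → δ y z) (λ y → count y zs) K ⟨
  sum (map (λ y → count y (z ∷ zs)) K)                           ∎
  where open ≤-Reasoning

∈-─ : ∀ {X : Set} {x y : X} {xs} (x∈xs : x ∈ xs) → y ∈ xs → x ≢ y → y ∈ xs ─ x∈xs
∈-─ (here refl)  (here refl)  x≢y = ⊥-elim (x≢y refl)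
∈-─ (here refl)  (there y∈xs) _   = y∈xs
∈-─ (there _)    (here refl)  _   = here refl
∈-─ (there x∈xs) (there y∈xs) x≢y = there (∈-─ x∈xs y∈xs x≢y)

-- Each distinct x with f x > 0 uses up its own entry of the cover xs.
sum-map≤*cover : ∀ {X : Set} (f : X → ℕ) {C} {L : List X} → Unique L → (∀ {x} → x ∈ L → f x ≤ C) →
  (xs : List X) → (∀ {x} → x ∈ L → 0 < f x → x ∈ xs) → sum (map f L) ≤ C * length xs
sum-map≤*cover f {L = []} _ _ _ _ = z≤n
sum-map≤*cover f {C} {x ∷ L} (x∉L ∷ unique-L) f≤C xs cover with f x in fx≡
... | zero  = sum-map≤*cover f unique-L (f≤C ∘ there) xs (cover ∘ there)
... | suc n = begin
  suc n + sum (map f L)        ≤⟨ +-mono-≤ (subst (_≤ C) fx≡ (f≤C (here refl))) rest ⟩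
  C + C * length (xs ─ x∈xs)   ≡⟨ *-suc C _ ⟨
  C * suc (length (xs ─ x∈xs)) ≡⟨ cong (_*_ C) (length-removeAt′ xs (index x∈xs)) ⟨
  C * length xs                ∎
  where
  open ≤-Reasoning
  x∈xs : x ∈ xs
  x∈xs = cover (here refl) (subst (0 <_) (sym fx≡) (s≤s z≤n))
  rest : sum (map f L) ≤ C * length (xs ─ x∈xs)
  rest = sum-map≤*cover f unique-L (f≤C ∘ there) (xs ─ x∈xs)
    λ y∈L pos → ∈-─ x∈xs (cover (there y∈L) pos) (All.lookup x∉L y∈L)

_⊕_ : List ℕ → List ℕ → List ℕ
[]      ⊕ S = []
(x ∷ L) ⊕ S = map (_+_ x) S ++ L ⊕ S

sums : List ℕ → ℕ → List ℕ
sums L zero    = 0 ∷ []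
sums L (suc j) = L ⊕ sums L j

length-⊕ : ∀ L S → length (L ⊕ S) ≡ length L * length S
length-⊕ []      S = refl
length-⊕ (x ∷ L) S = trans (length-++ (map (_+_ x) S)) (cong₂ _+_ (length-map (_+_ x) S) (length-⊕ L S))

length-sums : ∀ L j → length (sums L j) ≡ length L ^ j
length-sums L zero    = refl
length-sums L (suc j) = trans (length-⊕ L (sums L j)) (cong (_*_ (length L)) (length-sums L j))

∈-⊕⁻ : ∀ {z} L S → z ∈ L ⊕ S → ∃[ x ] ∃[ w ] x ∈ L × w ∈ S × z ≡ x + w
∈-⊕⁻ (x ∷ L) S z∈ with ∈-++⁻ (map (_+_ x) S) z∈
... | inj₁ z∈x+S with w , w∈S , z≡ ← ∈-map⁻ (_+_ x) z∈x+S = x , w , here refl , w∈S , z≡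
... | inj₂ z∈L⊕S with x′ , w , x′∈L , w∈S , z≡ ← ∈-⊕⁻ L S z∈L⊕S = x′ , w , there x′∈L , w∈S , z≡

sums⊆· : ∀ {B : ℕ → Set} {L} → (∀ {x} → x ∈ L → B x) → ∀ j {z} → z ∈ sums L j → (j · B) z
sums⊆· L⊆B zero    (here refl) = [] , [] , refl
sums⊆· {L = L} L⊆B (suc j) z∈ with x , w , x∈L , w∈S , refl ← ∈-⊕⁻ L (sums L j) z∈
                               with v , Bv , refl ← sums⊆· L⊆B j w∈S
  = x ∷ v , L⊆B x∈L ∷ Bv , refl

count-⊕ : ∀ y L S → count y (L ⊕ S) ≡ sum (map (λ x → count y (map (_+_ x) S)) L)
count-⊕ y []      S = refl
count-⊕ y (x ∷ L) S = trans (count-++ y (map (_+_ x) S) (L ⊕ S)) (cong (_+_ (count y (map (_+_ x) S))) (count-⊕ y L S))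

count-sums-suc≤ : ∀ {C} L j {y} → Unique L → (∀ y′ → count y′ (sums L j) ≤ C) → (xs : List ℕ) →
  (∀ {x w} → x ∈ L → w ∈ sums L j → y ≡ x + w → x ∈ xs) →
  count y (sums L (suc j)) ≤ C * length xs
count-sums-suc≤ {C} L j {y} unique-L count≤C xs cover = begin
  count y (L ⊕ sums L j)                               ≡⟨ count-⊕ y L (sums L j) ⟩
  sum (map (λ x → count y (map (_+_ x) (sums L j))) L) ≤⟨ sum-map≤*cover _ unique-L
                                                           (λ {x} _ → ≤-trans (count-map-+ y x (sums L j)) (count≤C (y ∸ x)))
                                                           xs first-summand∈xs ⟩
  C * length xs                                        ∎
  where
  open ≤-Reasoning
  first-summand∈xs : ∀ {x} → x ∈ L → 0 < count y (map (_+_ x) (sums L j)) → x ∈ xs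
  first-summand∈xs x∈L pos with w , w∈S , y≡ ← ∈-map⁻ (_+_ _) (count>0⇒∈ _ pos) = cover x∈L w∈S y≡

length^≤*length : ∀ {C} L K j → Unique K → (∀ {z} → z ∈ sums L j → z ∈ K) →
  (∀ y → count y (sums L j) ≤ C) → length L ^ j ≤ C * length K
length^≤*length {C} L K j unique-K sums⊆K count≤C = begin
  length L ^ j                                 ≡⟨ length-sums L j ⟨
  length (sums L j)                            ≤⟨ length≤sum-count K (sums L j) sums⊆K ⟩
  sum (map (λ y → count y (sums L j)) K)       ≤⟨ sum-map≤*cover _ unique-K (λ {y} _ → count≤C y) K (λ y∈K _ → y∈K) ⟩
  C * length K                                 ∎
  where open ≤-Reasoning

module _ {Z : Expansion} where
  open Expansion Z

  mutual
    renT : ∀ {n n′} → (Fin n → Fin n′) → Term Z n → Term Z n′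
    renT r (var i)    = var (r i)
    renT r (app f ts) = app f (renTs r ts)

    renTs : ∀ {n n′ k} → (Fin n → Fin n′) → Vec (Term Z n) k → Vec (Term Z n′) k
    renTs r []       = []
    renTs r (t ∷ ts) = renT r t ∷ renTs r ts

  ren : ∀ {n n′} → (Fin n → Fin n′) → Formula Z n → Formula Z n′
  ren r (s ≐ t)    = renT r s ≐ renT r t
  ren r (rel R ts) = rel R (renTs r ts)
  ren r ⊥f         = ⊥f
  ren r (φ ⇒f ψ)   = ren r φ ⇒f ren r ψ
  ren r (φ ∧f ψ)   = ren r φ ∧f ren r ψ
  ren r (φ ∨f ψ)   = ren r φ ∨f ren r ψ
  ren r (∀f φ)     = ∀f (ren (lift 1 r) φ)
  ren r (∃f φ)     = ∃f (ren (lift 1 r) φ)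

  module _ {n n′} (r : Fin n → Fin n′) {ρ : Vec ℤ n′} {ρ′ : Vec ℤ n}
           (ρ∘r≗ρ′ : ∀ i → lookup ρ (r i) ≡ lookup ρ′ i) where
    mutual
      evalT-ren : ∀ t → evalT Z ρ (renT r t) ≡ evalT Z ρ′ t
      evalT-ren (var i)    = ρ∘r≗ρ′ i
      evalT-ren (app f ts) = cong (funI f) (evalTs-ren ts)

      evalTs-ren : ∀ {k} (ts : Vec (Term Z n) k) → evalTs Z ρ (renTs r ts) ≡ evalTs Z ρ′ ts
      evalTs-ren []       = refl
      evalTs-ren (t ∷ ts) = cong₂ _∷_ (evalT-ren t) (evalTs-ren ts)

  lookup-lift : ∀ {n n′} {ρ : Vec ℤ n′} {ρ′ : Vec ℤ n} {r : Fin n → Fin n′} z → (∀ i → lookup ρ (r i) ≡ lookup ρ′ i) →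
    ∀ i → lookup (z ∷ ρ) (lift 1 r i) ≡ lookup (z ∷ ρ′) i
  lookup-lift z _      zero    = refl
  lookup-lift z ρ∘r≗ρ′ (suc i) = ρ∘r≗ρ′ i

  subst-⇔ : ∀ {X : Set} (P : X → Set) {x y} → x ≡ y → P x ⇔ P y
  subst-⇔ P refl = ⇔-id _

  ≡-cong-⇔ : ∀ {a a′ b b′ : ℤ} → a ≡ a′ → b ≡ b′ → (a ≡ b) ⇔ (a′ ≡ b′)
  ≡-cong-⇔ refl refl = ⇔-id _

  ∀-⇔ : {P Q : ℤ → Set} → (∀ z → P z ⇔ Q z) → (∀ z → P z) ⇔ (∀ z → Q z)
  ∀-⇔ P⇔Q = mk⇔ (λ p z → to (P⇔Q z) (p z)) (λ q z → from (P⇔Q z) (q z))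

  ∃-⇔ : {P Q : ℤ → Set} → (∀ z → P z ⇔ Q z) → Σ ℤ P ⇔ Σ ℤ Q
  ∃-⇔ P⇔Q = mk⇔ (λ (z , p) → z , to (P⇔Q z) p) (λ (z , q) → z , from (P⇔Q z) q)

  Sat-ren : ∀ {n n′} (r : Fin n → Fin n′) (φ : Formula Z n) {ρ : Vec ℤ n′} {ρ′ : Vec ℤ n} →
    (∀ i → lookup ρ (r i) ≡ lookup ρ′ i) → Sat Z (ren r φ) ρ ⇔ Sat Z φ ρ′
  Sat-ren r (s ≐ t)    ρ∘r≗ρ′ = ≡-cong-⇔ (evalT-ren r ρ∘r≗ρ′ s) (evalT-ren r ρ∘r≗ρ′ t)
  Sat-ren r (rel R ts) ρ∘r≗ρ′ = subst-⇔ (relI R) (evalTs-ren r ρ∘r≗ρ′ ts)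
  Sat-ren r ⊥f       ρ∘r≗ρ′ = ⇔-id ⊥
  Sat-ren r (φ ⇒f ψ) ρ∘r≗ρ′ = →-cong-⇔ (Sat-ren r φ ρ∘r≗ρ′) (Sat-ren r ψ ρ∘r≗ρ′)
  Sat-ren r (φ ∧f ψ) ρ∘r≗ρ′ = Sat-ren r φ ρ∘r≗ρ′ ×-⇔ Sat-ren r ψ ρ∘r≗ρ′
  Sat-ren r (φ ∨f ψ) ρ∘r≗ρ′ = Sat-ren r φ ρ∘r≗ρ′ ⊎-⇔ Sat-ren r ψ ρ∘r≗ρ′
  Sat-ren r (∀f φ)   ρ∘r≗ρ′ = ∀-⇔ λ z → Sat-ren (lift 1 r) φ (lookup-lift z ρ∘r≗ρ′)
  Sat-ren r (∃f φ)   ρ∘r≗ρ′ = ∃-⇔ λ z → Sat-ren (lift 1 r) φ (lookup-lift z ρ∘r≗ρ′)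

  -- at k i φ is φ(xᵢ, b̄) in a context of k new variables x₀ … x_{k-1} before the parameters b̄.
  at : ∀ k {m} → Fin k → Formula Z (suc m) → Formula Z (k + m)
  at k {m} i = ren focus
    where
    focus : Fin (suc m) → Fin (k + m)
    focus zero    = i ↑ˡ m
    focus (suc p) = k ↑ʳ p

  Sat-at : ∀ {k m} (i : Fin k) (φ : Formula Z (suc m)) (xs : Vec ℤ k) (b : Vec ℤ m) →
    Sat Z (at k i φ) (xs Vec.++ b) ⇔ Sat Z φ (lookup xs i ∷ b)
  Sat-at i φ xs b = Sat-ren _ φ λ { zero → lookup-++ˡ xs b i ; (suc p) → lookup-++ʳ xs b p }

  infix 30 _⊕ᵗ_
  _⊕ᵗ_ : ∀ {n} → Fin n → Fin n → Term Z n
  i ⊕ᵗ j = app plusS (var i ∷ var j ∷ [])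

Defines : (Z : Expansion) {m : ℕ} → Formula Z (suc m) → Vec ℤ m → (ℕ → Set) → Set
Defines Z φ b A = ∀ z → Sat Z φ (z ∷ b) ⇔ (Σ ℕ λ a → (z ≡ + a) × A a)

module _ {Z : Expansion} {m} (φ : Formula Z (suc m)) where
  open Expansion Z

  sumsetFormula : ℕ → Formula Z (suc m)
  sumsetFormula zero    = var zero ≐ app zeroS []
  sumsetFormula (suc j) =
    ∃f (∃f ((at 3 zero φ ∧f at 3 (suc zero) (sumsetFormula j)) ∧f (zero ⊕ᵗ suc zero ≐ var (suc (suc zero)))))

  summandFormula : ℕ → Formula Z (suc (suc m))
  summandFormula j = at 2 zero φ ∧f ∃f ((zero ⊕ᵗ suc zero ≐ var (suc (suc zero))) ∧f at 3 zero (sumsetFormula j))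

module _ {Z : Expansion} {A : ℕ → Set} {m} (φ : Formula Z (suc m)) (b : Vec ℤ m) (φ-defines-A : Defines Z φ b A) where
  open Expansion Z

  sumsetFormula-sound : ∀ j z → Sat Z (sumsetFormula φ j) (z ∷ b) → Σ ℕ λ c → (z ≡ + c) × (j · A) c
  sumsetFormula-sound zero    z z≡0 = 0 , trans z≡0 zeroI , [] , [] , refl
  sumsetFormula-sound (suc j) z (v , u , (φu , Sv) , u+v≡z)
    with to (φ-defines-A u) (to (Sat-at zero φ (u ∷ v ∷ z ∷ []) b) φu)
       | sumsetFormula-sound j v (to (Sat-at (suc zero) (sumsetFormula φ j) (u ∷ v ∷ z ∷ []) b) Sv)
  ... | a , refl , Aa | c , refl , cs , Acs , Σcs≡c =
    a + c , trans (sym u+v≡z) (plusI (+ a) (+ c)) , a ∷ cs , Aa ∷ Acs , cong (_+_ a) Σcs≡c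

  sumsetFormula-complete : ∀ j c → (j · A) c → Sat Z (sumsetFormula φ j) (+ c ∷ b)
  sumsetFormula-complete zero    _ ([] , [] , refl) = sym zeroI
  sumsetFormula-complete (suc j) _ (a ∷ cs , Aa ∷ Acs , refl) =
    + Vec.sum cs , + a ,
    ( from (Sat-at zero φ (+ a ∷ + Vec.sum cs ∷ + (a + Vec.sum cs) ∷ []) b)
        (from (φ-defines-A (+ a)) (a , refl , Aa))
    , from (Sat-at (suc zero) (sumsetFormula φ j) (+ a ∷ + Vec.sum cs ∷ + (a + Vec.sum cs) ∷ []) b)
        (sumsetFormula-complete j (Vec.sum cs) (cs , Acs , refl)) ) ,
    plusI (+ a) (+ Vec.sum cs)

  summandFormula-complete : ∀ j {x w y} → A x → (j · A) w → y ≡ x + w →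
    Sat Z (summandFormula φ j) (+ x ∷ + y ∷ b)
  summandFormula-complete j {x} {w} Ax jAw refl =
    from (Sat-at zero φ (+ x ∷ + (x + w) ∷ []) b) (from (φ-defines-A (+ x)) (x , refl , Ax)) ,
    + w ,
    trans (plusI (+ w) (+ x)) (cong +_ (+-comm w x)) ,
    from (Sat-at zero (sumsetFormula φ j) (+ w ∷ + x ∷ + (x + w) ∷ []) b) (sumsetFormula-complete j w jAw)

  summandFormula-fibre-finite : ∀ j n → Finite (λ z → Sat Z (summandFormula φ j) (z ∷ + n ∷ b))
  summandFormula-fibre-finite j n = map +_ (upTo (suc n)) , fibre⊆[0,n]
    where
    fibre⊆[0,n] : ∀ z → Sat Z (summandFormula φ j) (z ∷ + n ∷ b) → z ∈ map +_ (upTo (suc n))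
    fibre⊆[0,n] z (φz , w , w+z≡n , Sw)
      with to (φ-defines-A z) (to (Sat-at zero φ (z ∷ + n ∷ []) b) φz)
         | sumsetFormula-sound j w (to (Sat-at zero (sumsetFormula φ j) (w ∷ z ∷ + n ∷ []) b) Sw)
    ... | a , refl , _ | c , refl , _ =
      ∈-map⁺ +_ (∈-upTo⁺ (s≤s (subst (a ≤_) (+-injective (trans (sym (plusI (+ c) (+ a))) w+z≡n)) (m≤n+m a c))))

module _ {Z : Expansion} {A : ℕ → Set} {m} (φ : Formula Z (suc m)) (b : Vec ℤ m)
         (φ-defines-A : Defines Z φ b A) (elim : EliminatesExistsInfinity Z) where

  fibreBound : ℕ → ℕ
  fibreBound j = proj₁ (elim (suc m) (summandFormula φ j))

  representationBound : ℕ → ℕ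
  representationBound zero    = 1
  representationBound (suc j) = representationBound j * fibreBound j

  count-sums≤representationBound : ∀ {L} → Unique L → (∀ {x} → x ∈ L → A x) →
    ∀ j y → count y (sums L j) ≤ representationBound j
  count-sums≤representationBound _ _ zero y = ≤-trans (≤-reflexive (+-identityʳ (δ y 0))) (δ≤1 y 0)
  count-sums≤representationBound {L} unique-L L⊆A (suc j) y =
    ≤-trans (count-sums-suc≤ L j unique-L (count-sums≤representationBound unique-L L⊆A j) (map ∣_∣ fibre) cover)
            (*-monoʳ-≤ (representationBound j) (<⇒≤ (subst (_< fibreBound j) (sym (length-map ∣_∣ fibre)) fibre<N)))
    where
    bounded : FiniteBelow (fibreBound j) (λ z → Sat Z (summandFormula φ j) (z ∷ + y ∷ b))
    bounded = proj₂ (elim (suc m) (summandFormula φ j)) (+ y ∷ b) (summandFormula-fibre-finite φ b φ-defines-A j y)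
    fibre : List ℤ
    fibre = proj₁ bounded
    fibre<N : length fibre < fibreBound j
    fibre<N = proj₁ (proj₂ bounded)
    cover : ∀ {x w} → x ∈ L → w ∈ sums L j → y ≡ x + w → x ∈ map ∣_∣ fibre
    cover x∈L w∈S y≡ = ∈-map⁺ ∣_∣ (proj₂ (proj₂ bounded) _
      (summandFormula-complete φ b φ-defines-A j (L⊆A x∈L) (sums⊆· L⊆A j w∈S) y≡))

  card^k≤representationBound*card : ∀ k {n a s} → HasCard (A ≤[ n ]) a → HasCard (k · (A ≤[ n ])) s →
    a ^ k ≤ representationBound k * s
  card^k≤representationBound*card k (L , unique-L , ∈L⇔ , refl) (K , unique-K , ∈K⇔ , refl) =
    length^≤*length L K k unique-K
      (λ z∈ → from (∈K⇔ _) (sums⊆· (λ x∈L → to (∈L⇔ _) x∈L) k z∈))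
      (count-sums≤representationBound unique-L (λ x∈L → proj₁ (to (∈L⇔ _) x∈L)) k)

card^k≤*card⇒largeTupling : ∀ k A C → (∀ n {a s} → HasCard (A ≤[ n ]) a → HasCard (k · (A ≤[ n ])) s → a ^ k ≤ C * s) →
  LargeLowerAsymptoticTupling k A
card^k≤*card⇒largeTupling k A C bound =
  0 , C , 0 , λ n _ a s cardA cardS →
    ≤-trans (≤-reflexive (*-identityˡ (a ^ k))) (≤-trans (bound n cardA cardS) (m≤n+m (C * s) s))

lemma4p17 : (Z : Expansion) (A : ℕ → Set) → Infinite A → Definable Z A →
    (k : ℕ) → 2 ≤ k → ¬ LargeLowerAsymptoticTupling k A →
    ¬ EliminatesExistsInfinity Z
lemma4p17 Z A _ (m , φ , b , φ-defines-A) k _ notLarge elim =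
  notLarge (card^k≤*card⇒largeTupling k A (representationBound φ b φ-defines-A elim k)
    λ n → card^k≤representationBound*card φ b φ-defines-A elim k)
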